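{- Let $(\mathbb{X},\dagger)$ be a dagger kernel category which is dagger idempotent complete and has finite $\dagger$-biproducts and negatives. Then a map $f: A\to B$ is Moore-Penrose invertible if and only if $f$ has a generalized singular value decomposition.
   Context: Composition is in diagrammatic order ($fg$ means $f$ then $g$). A dagger category is a category with an identity-on-objects contravariant involutive functor $\dagger$ ($f: A\to B$ gives $f^\dagger: B\to A$, $(fg)^\dagger = g^\dagger f^\dagger$, $f^{\dagger\dagger} = f$, $1^\dagger = 1$). Isometry: $s: A\to B$ with $ss^\dagger = 1_A$; unitary: $u$ with $uu^\dagger = 1$ and $u^\dagger u = 1$. A Moore-Penrose inverse of $f: A\to B$ is $f^\circ: B \to A$ with $ff^\circ f = f$, $f^\circ f f^\circ = f^\circ$, $(ff^\circ)^\dagger = ff^\circ$, $(f^\circ f)^\dagger = f^\circ f$. A $\dagger$-idempotent is $e$ with $ee=e=e^\dagger$; it $\dagger$-splits if $e = rr^\dagger$ for some $r: A\to X$ with $r^\dagger r = 1_X$; dagger idempotent complete means all $\dagger$-idempotents $\dagger$-split. Finite $\dagger$-biproducts: finite biproducts $\oplus$ (with zero object $\mathsf{0}$, projections $\pi_j$, injections $\iota_j$) such that $\pi_j^\dagger = \iota_j$. Negatives: each hom-set, which is a commutative monoid under the biproduct-induced addition, is an abelian group. A $\dagger$-kernel of $f: A \to B$ is a kernel $k: \mathsf{ker}(f)\to A$ (so $kf = 0$, universally) which is an isometry; a dagger kernel category is a dagger category with a zero object in which every map has a $\dagger$-kernel. A generalized singular value decomposition (GSVD) of $f: A \to B$ is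 a triple $(u: A \to X\oplus Z, d: X \to Y, v: Y \oplus W \to B)$ with $u,v$ unitary, $d$ an isomorphism, and $f = u(d\oplus 0)v$, where $0: Z \to W$ is the zero map. -}

module Defs where

open import Level using (Level; _⊔_) renaming (suc to lsuc)
open import Relation.Binary using (Rel; IsEquivalence)
open import Data.Product using (Σ; _×_; _,_; proj₁)

-- Dagger categories, with setoid-valued hom-sets; composition is diagrammatic:
-- f ⨾ g means "f then g".
record DaggerCategory (o ℓ e : Level) : Set (lsuc (o ⊔ ℓ ⊔ e)) where
  infixr 9 _⨾_
  infix  4 _≈_
  infix  10 _†
  field
    Obj   : Set o
    Hom   : Obj → Obj → Set ℓ
    _≈_   : ∀ {A B} → Rel (Hom A B) e
    ≈-equiv : ∀ {A B} → IsEquivalence (_≈_ {A} {B})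
    id    : ∀ {A} → Hom A A
    _⨾_   : ∀ {A B C} → Hom A B → Hom B C → Hom A C
    assoc : ∀ {A B C D} {f : Hom A B} {g : Hom B C} {h : Hom C D} →
            (f ⨾ g) ⨾ h ≈ f ⨾ (g ⨾ h)
    idˡ   : ∀ {A B} {f : Hom A B} → id ⨾ f ≈ f
    idʳ   : ∀ {A B} {f : Hom A B} → f ⨾ id ≈ f
    ⨾-resp : ∀ {A B C} {f f' : Hom A B} {g g' : Hom B C} →
             f ≈ f' → g ≈ g' → f ⨾ g ≈ f' ⨾ g'
    _†    : ∀ {A B} → Hom A B → Hom B A
    †-resp : ∀ {A B} {f f' : Hom A B} → f ≈ f' → f † ≈ f' †
    †-comp : ∀ {A B C} {f : Hom A B} {g : Hom B C} → (f ⨾ g) † ≈ g † ⨾ f †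
    †-invol : ∀ {A B} {f : Hom A B} → f † † ≈ f
    †-id  : ∀ {A} → (id {A}) † ≈ id

module _ {o ℓ e : Level} (𝕏 : DaggerCategory o ℓ e) where
  open DaggerCategory 𝕏

  IsIsometry : ∀ {A B} → Hom A B → Set e
  IsIsometry s = s ⨾ s † ≈ id

  IsUnitary : ∀ {A B} → Hom A B → Set e
  IsUnitary u = (u ⨾ u † ≈ id) × (u † ⨾ u ≈ id)

  IsIso : ∀ {A B} → Hom A B → Set (ℓ ⊔ e)
  IsIso {A} {B} d = Σ (Hom B A) λ d' → (d ⨾ d' ≈ id) × (d' ⨾ d ≈ id)

  IsMoorePenroseInverse : ∀ {A B} → Hom A B → Hom B A → Set e
  IsMoorePenroseInverse f g =
    (f ⨾ g ⨾ f ≈ f) × (g ⨾ f ⨾ g ≈ g) ×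
    ((f ⨾ g) † ≈ f ⨾ g) × ((g ⨾ f) † ≈ g ⨾ f)

  MoorePenroseInvertible : ∀ {A B} → Hom A B → Set (ℓ ⊔ e)
  MoorePenroseInvertible {A} {B} f = Σ (Hom B A) λ g → IsMoorePenroseInverse f g

  DaggerIdempotentComplete : Set (o ⊔ ℓ ⊔ e)
  DaggerIdempotentComplete =
    ∀ {A} (e' : Hom A A) → e' ⨾ e' ≈ e' → e' † ≈ e' →
    Σ Obj λ X → Σ (Hom A X) λ r → (r ⨾ r † ≈ e') × (r † ⨾ r ≈ id)

  record ZeroObject : Set (o ⊔ ℓ ⊔ e) where
    field
      𝟘 : Obj
      ! : ∀ A → Hom A 𝟘
      !-unique : ∀ {A} (h : Hom A 𝟘) → h ≈ ! A
      ¡ : ∀ A → Hom 𝟘 A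
      ¡-unique : ∀ {A} (h : Hom 𝟘 A) → h ≈ ¡ A

    zero : ∀ {A B} → Hom A B
    zero {A} {B} = ! A ⨾ ¡ B

  module _ (Z : ZeroObject) where
    open ZeroObject Z

    record DaggerKernel {A B} (f : Hom A B) : Set (o ⊔ ℓ ⊔ e) where
      field
        K : Obj
        k : Hom K A
        k-zero : k ⨾ f ≈ zero
        k-isometry : IsIsometry k
        universal : ∀ {C} (g : Hom C A) → g ⨾ f ≈ zero →
                    Σ (Hom C K) λ h → (h ⨾ k ≈ g) ×
                      (∀ (h' : Hom C K) → h' ⨾ k ≈ g → h' ≈ h)

    HasDaggerKernels : Set (o ⊔ ℓ ⊔ e)
    HasDaggerKernels = ∀ {A B} (f : Hom A B) → DaggerKernel f

    record DaggerBiproduct (A B : Obj) : Set (o ⊔ ℓ ⊔ e) where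
      field
        A⊕B : Obj
        π₁ : Hom A⊕B A
        π₂ : Hom A⊕B B
        ι₁ : Hom A A⊕B
        ι₂ : Hom B A⊕B
        ι₁π₁ : ι₁ ⨾ π₁ ≈ id
        ι₂π₂ : ι₂ ⨾ π₂ ≈ id
        ι₁π₂ : ι₁ ⨾ π₂ ≈ zero
        ι₂π₁ : ι₂ ⨾ π₁ ≈ zero
        pair : ∀ {C} (f : Hom C A) (g : Hom C B) →
               Σ (Hom C A⊕B) λ h → (h ⨾ π₁ ≈ f) × (h ⨾ π₂ ≈ g) ×
                 (∀ (h' : Hom C A⊕B) → h' ⨾ π₁ ≈ f → h' ⨾ π₂ ≈ g → h' ≈ h)
        copair : ∀ {C} (f : Hom A C) (g : Hom B C) →
                 Σ (Hom A⊕B C) λ h → (ι₁ ⨾ h ≈ f) × (ι₂ ⨾ h ≈ g) ×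
                   (∀ (h' : Hom A⊕B C) → ι₁ ⨾ h' ≈ f → ι₂ ⨾ h' ≈ g → h' ≈ h)
        π₁† : π₁ † ≈ ι₁
        π₂† : π₂ † ≈ ι₂

      ⟨_,_⟩ : ∀ {C} → Hom C A → Hom C B → Hom C A⊕B
      ⟨ f , g ⟩ = proj₁ (pair f g)

      [_,_] : ∀ {C} → Hom A C → Hom B C → Hom A⊕B C
      [ f , g ] = proj₁ (copair f g)

    -- finite dagger biproducts = zero object (Z) + all binary dagger biproducts
    FiniteDaggerBiproducts : Set (o ⊔ ℓ ⊔ e)
    FiniteDaggerBiproducts = ∀ A B → DaggerBiproduct A B

    module _ (BP : FiniteDaggerBiproducts) where
      open DaggerBiproduct

      _⊕_ : Obj → Obj → Obj
      A ⊕ B = A⊕B (BP A B)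

      _⊕₁_ : ∀ {A B C D} → Hom A B → Hom C D → Hom (A ⊕ C) (B ⊕ D)
      _⊕₁_ {A} {B} {C} {D} f g =
        ⟨ BP B D , π₁ (BP A C) ⨾ f ⟩ (π₂ (BP A C) ⨾ g)

      _+_ : ∀ {A B} → Hom A B → Hom A B → Hom A B
      _+_ {A} {B} f g = ⟨ BP B B , f ⟩ g ⨾ [ BP B B , id ] id

      HasNegatives : Set (o ⊔ ℓ ⊔ e)
      HasNegatives = ∀ {A B} (f : Hom A B) → Σ (Hom A B) λ g → f + g ≈ zero

      HasGSVD : ∀ {A B} → Hom A B → Set (o ⊔ ℓ ⊔ e)
      HasGSVD {A} {B} f =
        Σ Obj λ X → Σ Obj λ Y → Σ Obj λ Z' → Σ Obj λ W →
        Σ (Hom A (X ⊕ Z')) λ u → Σ (Hom X Y) λ d → Σ (Hom (Y ⊕ W) B) λ v →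
          IsUnitary u × IsIso d × IsUnitary v ×
          (f ≈ u ⨾ (d ⊕₁ zero {Z'} {W}) ⨾ v)

{-# OPTIONS --safe #-}
-- If f = u (d ⊕ 0) v with u, v unitary and d invertible, then v† (d⁻¹ ⊕ 0) u† is a
-- Moore-Penrose inverse of f: Moore-Penrose inverses are preserved by direct sums and by
-- unitary conjugation, and inverses and zero maps are Moore-Penrose inverses of each other.
--
-- Conversely, if g is a Moore-Penrose inverse of f, then f g and g f are dagger idempotents.
-- With negatives, a dagger idempotent ε has the orthogonal complement 1 - ε, and dagger
-- splittings r of ε and s of 1 - ε assemble into a unitary ⟨ r , s ⟩ : A → X ⊕ X⊥. Doing this
-- for f g (splitting r) and g f (splitting p), the compression d = r† f p is invertible with
-- inverse p† g r, and f = r d p† is exactly the decomposition u (d ⊕ 0) v.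
module Submission where

open import Defs hiding (_⊕_; _⊕₁_; _+_)
open import Level using (Level; _⊔_)
open import Function.Bundles using (_⇔_; mk⇔)
open import Data.Product using (Σ; _×_; _,_; proj₁; proj₂)
open import Relation.Binary.Bundles using (Setoid)
open import Relation.Binary.Structures using (IsEquivalence)
import Relation.Binary.Reasoning.Setoid as SetoidReasoning

module _ {o ℓ e : Level} (𝕏 : DaggerCategory o ℓ e) where
  open DaggerCategory 𝕏

  private
    variable
      A B C D E F : Obj

  homSetoid : Obj → Obj → Setoid ℓ e
  homSetoid A B = record { isEquivalence = ≈-equiv {A} {B} }

  module Equiv {A B : Obj} = IsEquivalence (≈-equiv {A} {B})
  module HomReasoning {A B : Obj} = SetoidReasoning (homSetoid A B)
  open HomReasoning

  infixr 4 _⟩⨾⟨_ refl⟩⨾⟨_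
  infixl 5 _⟩⨾⟨refl

  _⟩⨾⟨_ : {f f' : Hom A B} {g g' : Hom B C} → f ≈ f' → g ≈ g' → f ⨾ g ≈ f' ⨾ g'
  _⟩⨾⟨_ = ⨾-resp

  refl⟩⨾⟨_ : {f : Hom A B} {g g' : Hom B C} → g ≈ g' → f ⨾ g ≈ f ⨾ g'
  refl⟩⨾⟨_ = ⨾-resp Equiv.refl

  _⟩⨾⟨refl : {f f' : Hom A B} {g : Hom B C} → f ≈ f' → f ⨾ g ≈ f' ⨾ g
  p ⟩⨾⟨refl = ⨾-resp p Equiv.refl

  sym-assoc : {f : Hom A B} {g : Hom B C} {h : Hom C D} → f ⨾ g ⨾ h ≈ (f ⨾ g) ⨾ h
  sym-assoc = Equiv.sym assoc

  †-sandwich : {a : Hom A B} {z : Hom B B} → (a ⨾ z ⨾ a †) † ≈ a ⨾ z † ⨾ a †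
  †-sandwich {a = a} {z} = begin
    (a ⨾ z ⨾ a †) †      ≈⟨ †-comp ⟩
    (z ⨾ a †) † ⨾ a †    ≈⟨ †-comp ⟩⨾⟨refl ⟩
    (a † † ⨾ z †) ⨾ a †  ≈⟨ (†-invol ⟩⨾⟨refl) ⟩⨾⟨refl ⟩
    (a ⨾ z †) ⨾ a †      ≈⟨ assoc ⟩
    a ⨾ z † ⨾ a †        ∎

  sandwich-⨾ : {a : Hom A B} {x : Hom B C} {b : Hom C D} {m : Hom C C} {b' : Hom D C}
               {y : Hom C E} {c : Hom E F} →
               b ⨾ b' ≈ m → (a ⨾ x ⨾ b) ⨾ (b' ⨾ y ⨾ c) ≈ a ⨾ (x ⨾ m ⨾ y) ⨾ c
  sandwich-⨾ {a = a} {x} {b} {m} {b'} {y} {c} bb' = begin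
    (a ⨾ x ⨾ b) ⨾ (b' ⨾ y ⨾ c)  ≈⟨ assoc ⟩
    a ⨾ (x ⨾ b) ⨾ b' ⨾ y ⨾ c    ≈⟨ refl⟩⨾⟨ assoc ⟩
    a ⨾ x ⨾ b ⨾ b' ⨾ y ⨾ c      ≈⟨ refl⟩⨾⟨ refl⟩⨾⟨ sym-assoc ⟩
    a ⨾ x ⨾ (b ⨾ b') ⨾ y ⨾ c    ≈⟨ refl⟩⨾⟨ refl⟩⨾⟨ bb' ⟩⨾⟨refl ⟩
    a ⨾ x ⨾ m ⨾ y ⨾ c           ≈⟨ refl⟩⨾⟨ refl⟩⨾⟨ sym-assoc ⟩
    a ⨾ x ⨾ (m ⨾ y) ⨾ c         ≈⟨ refl⟩⨾⟨ sym-assoc ⟩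
    a ⨾ (x ⨾ m ⨾ y) ⨾ c         ∎

  sandwich-cancel : {a : Hom A B} {x : Hom B C} {b : Hom C D} {b' : Hom D C}
                    {y : Hom C E} {c : Hom E F} →
                    b ⨾ b' ≈ id → (a ⨾ x ⨾ b) ⨾ (b' ⨾ y ⨾ c) ≈ a ⨾ (x ⨾ y) ⨾ c
  sandwich-cancel bb' = Equiv.trans (sandwich-⨾ bb') (refl⟩⨾⟨ (refl⟩⨾⟨ idˡ) ⟩⨾⟨refl)

  unitary-† : {u : Hom A B} → IsUnitary 𝕏 u → IsUnitary 𝕏 (u †)
  unitary-† (uu† , u†u) = Equiv.trans (refl⟩⨾⟨ †-invol) u†u , Equiv.trans (†-invol ⟩⨾⟨refl) uu†

  isMoorePenroseInverse-sym : {f : Hom A B} {g : Hom B A} →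
                              IsMoorePenroseInverse 𝕏 f g → IsMoorePenroseInverse 𝕏 g f
  isMoorePenroseInverse-sym (fgf , gfg , fg† , gf†) = gfg , fgf , gf† , fg†

  isMoorePenroseInverse⇒idempotent : {f : Hom A B} {g : Hom B A} →
                                     IsMoorePenroseInverse 𝕏 f g → (f ⨾ g) ⨾ f ⨾ g ≈ f ⨾ g
  isMoorePenroseInverse⇒idempotent (fgf , _) =
    Equiv.trans sym-assoc (Equiv.trans (assoc ⟩⨾⟨refl) (fgf ⟩⨾⟨refl))

  isMoorePenroseInverse-resp : {f f' : Hom A B} {g : Hom B A} → f ≈ f' →
                               IsMoorePenroseInverse 𝕏 f' g → IsMoorePenroseInverse 𝕏 f g
  isMoorePenroseInverse-resp {f = f} {f'} {g} f≈f' (fgf , gfg , fg† , gf†) =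
    fgf′ , Equiv.trans (refl⟩⨾⟨ f≈f' ⟩⨾⟨refl) gfg ,
    Equiv.trans (†-resp (f≈f' ⟩⨾⟨refl)) (Equiv.trans fg† (Equiv.sym f≈f' ⟩⨾⟨refl)) ,
    Equiv.trans (†-resp (refl⟩⨾⟨ f≈f')) (Equiv.trans gf† (refl⟩⨾⟨ Equiv.sym f≈f'))
    where
    fgf′ : f ⨾ g ⨾ f ≈ f
    fgf′ = begin
      f ⨾ g ⨾ f    ≈⟨ f≈f' ⟩⨾⟨ refl⟩⨾⟨ f≈f' ⟩
      f' ⨾ g ⨾ f'  ≈⟨ fgf ⟩
      f'           ≈⟨ f≈f' ⟨
      f            ∎

  inverse⇒isMoorePenroseInverse : {d : Hom A B} {d' : Hom B A} → d ⨾ d' ≈ id → d' ⨾ d ≈ id →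
                                  IsMoorePenroseInverse 𝕏 d d'
  inverse⇒isMoorePenroseInverse dd' d'd =
    Equiv.trans (refl⟩⨾⟨ d'd) idʳ , Equiv.trans (refl⟩⨾⟨ dd') idʳ ,
    self-adjoint dd' , self-adjoint d'd
    where
    self-adjoint : {h : Hom A A} → h ≈ id → h † ≈ h
    self-adjoint h≈id = Equiv.trans (†-resp h≈id) (Equiv.trans †-id (Equiv.sym h≈id))

  isMoorePenroseInverse-unitary-conj : {u : Hom A B} {f : Hom B C} {v : Hom C D} {g : Hom C B} →
    IsUnitary 𝕏 u → IsUnitary 𝕏 v → IsMoorePenroseInverse 𝕏 f g →
    IsMoorePenroseInverse 𝕏 (u ⨾ f ⨾ v) (v † ⨾ g ⨾ u †)
  isMoorePenroseInverse-unitary-conj {u = u} {f} {v} {g} (uu† , u†u) (vv† , v†v) (fgf , gfg , fg† , gf†) =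
    Equiv.trans (refl⟩⨾⟨ sandwich-cancel u†u) (Equiv.trans (sandwich-cancel vv†) (refl⟩⨾⟨ fgf ⟩⨾⟨refl)) ,
    Equiv.trans (refl⟩⨾⟨ sandwich-cancel vv†) (Equiv.trans (sandwich-cancel u†u) (refl⟩⨾⟨ gfg ⟩⨾⟨refl)) ,
    self-adjoint-conj (sandwich-cancel vv†) fg† ,
    self-adjoint-conj (Equiv.trans (sandwich-cancel u†u) (refl⟩⨾⟨ refl⟩⨾⟨ Equiv.sym †-invol)) gf†
    where
    self-adjoint-conj : {a : Hom A B} {h : Hom A A} {z : Hom B B} →
                        h ≈ a ⨾ z ⨾ a † → z † ≈ z → h † ≈ h
    self-adjoint-conj {a = a} {h} {z} h≈ z† = begin
      h †              ≈⟨ †-resp h≈ ⟩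
      (a ⨾ z ⨾ a †) †  ≈⟨ †-sandwich ⟩
      a ⨾ z † ⨾ a †    ≈⟨ refl⟩⨾⟨ z† ⟩⨾⟨refl ⟩
      a ⨾ z ⨾ a †      ≈⟨ h≈ ⟨
      h                ∎

  splitting-absorbˡ : {r : Hom A B} {ε : Hom A A} → r ⨾ r † ≈ ε → r † ⨾ r ≈ id → ε ⨾ r ≈ r
  splitting-absorbˡ {r = r} {ε} rr† r†r = begin
    ε ⨾ r          ≈⟨ rr† ⟩⨾⟨refl ⟨
    (r ⨾ r †) ⨾ r  ≈⟨ assoc ⟩
    r ⨾ r † ⨾ r    ≈⟨ refl⟩⨾⟨ r†r ⟩
    r ⨾ id         ≈⟨ idʳ ⟩
    r              ∎

  splitting-absorbʳ : {r : Hom A B} {ε : Hom A A} → r ⨾ r † ≈ ε → r † ⨾ r ≈ id → r † ⨾ ε ≈ r †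
  splitting-absorbʳ {r = r} {ε} rr† r†r = begin
    r † ⨾ ε          ≈⟨ refl⟩⨾⟨ rr† ⟨
    r † ⨾ r ⨾ r †    ≈⟨ sym-assoc ⟩
    (r † ⨾ r) ⨾ r †  ≈⟨ r†r ⟩⨾⟨refl ⟩
    id ⨾ r †         ≈⟨ idˡ ⟩
    r †              ∎

  compression-inverse : {f : Hom A B} {g : Hom B A} {r : Hom A C} {p : Hom B D} →
                        g ⨾ f ⨾ g ≈ g → r ⨾ r † ≈ f ⨾ g → r † ⨾ r ≈ id → p ⨾ p † ≈ g ⨾ f →
                        (r † ⨾ f ⨾ p) ⨾ (p † ⨾ g ⨾ r) ≈ id
  compression-inverse {f = f} {g} {r} {p} gfg rr† r†r pp† = begin
    (r † ⨾ f ⨾ p) ⨾ (p † ⨾ g ⨾ r)  ≈⟨ sandwich-⨾ pp† ⟩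
    r † ⨾ (f ⨾ (g ⨾ f) ⨾ g) ⨾ r    ≈⟨ refl⟩⨾⟨ (refl⟩⨾⟨ Equiv.trans assoc gfg) ⟩⨾⟨refl ⟩
    r † ⨾ (f ⨾ g) ⨾ r              ≈⟨ refl⟩⨾⟨ rr† ⟩⨾⟨refl ⟨
    r † ⨾ (r ⨾ r †) ⨾ r            ≈⟨ refl⟩⨾⟨ assoc ⟩
    r † ⨾ r ⨾ r † ⨾ r              ≈⟨ refl⟩⨾⟨ refl⟩⨾⟨ r†r ⟩
    r † ⨾ r ⨾ id                   ≈⟨ refl⟩⨾⟨ idʳ ⟩
    r † ⨾ r                        ≈⟨ r†r ⟩
    id                             ∎

  compression-reconstructs : {f : Hom A B} {g : Hom B A} {r : Hom A C} {p : Hom B D} →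
                             f ⨾ g ⨾ f ≈ f → r ⨾ r † ≈ f ⨾ g → p ⨾ p † ≈ g ⨾ f →
                             r ⨾ (r † ⨾ f ⨾ p) ⨾ p † ≈ f
  compression-reconstructs {f = f} {g} {r} {p} fgf rr† pp† = begin
    r ⨾ (r † ⨾ f ⨾ p) ⨾ p †    ≈⟨ refl⟩⨾⟨ assoc ⟩
    r ⨾ r † ⨾ (f ⨾ p) ⨾ p †    ≈⟨ sym-assoc ⟩
    (r ⨾ r †) ⨾ (f ⨾ p) ⨾ p †  ≈⟨ rr† ⟩⨾⟨ assoc ⟩
    (f ⨾ g) ⨾ f ⨾ p ⨾ p †      ≈⟨ refl⟩⨾⟨ refl⟩⨾⟨ pp† ⟩
    (f ⨾ g) ⨾ f ⨾ g ⨾ f        ≈⟨ refl⟩⨾⟨ fgf ⟩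
    (f ⨾ g) ⨾ f                ≈⟨ assoc ⟩
    f ⨾ g ⨾ f                  ≈⟨ fgf ⟩
    f                          ∎

  module _ (Z : ZeroObject 𝕏) where
    open ZeroObject Z

    zeroˡ : {f : Hom B C} → zero {A} ⨾ f ≈ zero
    zeroˡ = Equiv.trans assoc (refl⟩⨾⟨ ¡-unique _)

    zeroʳ : {f : Hom A B} → f ⨾ zero {B} {C} ≈ zero
    zeroʳ = Equiv.trans sym-assoc (!-unique _ ⟩⨾⟨refl)

    zero-† : zero {A} {B} † ≈ zero
    zero-† = Equiv.trans †-comp (!-unique _ ⟩⨾⟨ ¡-unique _)

    zero-isMoorePenroseInverse : IsMoorePenroseInverse 𝕏 (zero {A} {B}) zero
    zero-isMoorePenroseInverse =
      zeroˡ , zeroˡ , zero-self-adjoint , zero-self-adjoint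
      where
      zero-self-adjoint : (zero {C} {D} ⨾ zero {D} {C}) † ≈ zero ⨾ zero
      zero-self-adjoint = Equiv.trans (†-resp zeroˡ) (Equiv.trans zero-† (Equiv.sym zeroˡ))

    splittings-orthogonal : {r : Hom A B} {s : Hom A C} {ε c : Hom A A} →
                            r ⨾ r † ≈ ε → r † ⨾ r ≈ id → s ⨾ s † ≈ c → s † ⨾ s ≈ id →
                            c ⨾ ε ≈ zero → s † ⨾ r ≈ zero
    splittings-orthogonal {r = r} {s} {ε} {c} rr† r†r ss† s†s cε = begin
      s † ⨾ r              ≈⟨ splitting-absorbʳ ss† s†s ⟩⨾⟨ splitting-absorbˡ rr† r†r ⟨
      (s † ⨾ c) ⨾ ε ⨾ r    ≈⟨ assoc ⟩
      s † ⨾ c ⨾ ε ⨾ r      ≈⟨ refl⟩⨾⟨ sym-assoc ⟩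
      s † ⨾ (c ⨾ ε) ⨾ r    ≈⟨ refl⟩⨾⟨ cε ⟩⨾⟨refl ⟩
      s † ⨾ zero ⨾ r       ≈⟨ refl⟩⨾⟨ zeroˡ ⟩
      s † ⨾ zero           ≈⟨ zeroʳ ⟩
      zero                 ∎

    module _ (BP : FiniteDaggerBiproducts 𝕏 Z) where

      infix  8 _⊕_ _⊕₁_
      infixl 6 _+_

      _⊕_ : Obj → Obj → Obj
      _⊕_ = Defs._⊕_ 𝕏 Z BP

      _⊕₁_ : Hom A B → Hom C D → Hom (A ⊕ C) (B ⊕ D)
      _⊕₁_ = Defs._⊕₁_ 𝕏 Z BP

      _+_ : Hom A B → Hom A B → Hom A B
      _+_ = Defs._+_ 𝕏 Z BP

      module ⊕ {A B : Obj} = DaggerBiproduct (BP A B)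
      open ⊕ public using (π₁; π₂; ι₁; ι₂; ⟨_,_⟩; [_,_])

      ∇ : Hom (A ⊕ A) A
      ∇ = [ id , id ]

      project₁ : {f : Hom C A} {g : Hom C B} → ⟨ f , g ⟩ ⨾ π₁ ≈ f
      project₁ {f = f} {g} = proj₁ (proj₂ (⊕.pair f g))

      project₂ : {f : Hom C A} {g : Hom C B} → ⟨ f , g ⟩ ⨾ π₂ ≈ g
      project₂ {f = f} {g} = proj₁ (proj₂ (proj₂ (⊕.pair f g)))

      inject₁ : {f : Hom A C} {g : Hom B C} → ι₁ ⨾ [ f , g ] ≈ f
      inject₁ {f = f} {g} = proj₁ (proj₂ (⊕.copair f g))

      inject₂ : {f : Hom A C} {g : Hom B C} → ι₂ ⨾ [ f , g ] ≈ g
      inject₂ {f = f} {g} = proj₁ (proj₂ (proj₂ (⊕.copair f g)))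

      π-ext : {h h' : Hom C (A ⊕ B)} → h ⨾ π₁ ≈ h' ⨾ π₁ → h ⨾ π₂ ≈ h' ⨾ π₂ → h ≈ h'
      π-ext {C = C} {A = A} {B = B} {h = h} {h'} h₁ h₂ =
        Equiv.trans (unique h h₁ h₂) (Equiv.sym (unique h' Equiv.refl Equiv.refl))
        where
        unique : (k : Hom C (A ⊕ B)) → k ⨾ π₁ ≈ h' ⨾ π₁ → k ⨾ π₂ ≈ h' ⨾ π₂ → k ≈ ⟨ h' ⨾ π₁ , h' ⨾ π₂ ⟩
        unique = proj₂ (proj₂ (proj₂ (⊕.pair (h' ⨾ π₁) (h' ⨾ π₂))))

      ι-ext : {h h' : Hom (A ⊕ B) C} → ι₁ ⨾ h ≈ ι₁ ⨾ h' → ι₂ ⨾ h ≈ ι₂ ⨾ h' → h ≈ h'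
      ι-ext {A = A} {B = B} {C = C} {h = h} {h'} h₁ h₂ =
        Equiv.trans (unique h h₁ h₂) (Equiv.sym (unique h' Equiv.refl Equiv.refl))
        where
        unique : (k : Hom (A ⊕ B) C) → ι₁ ⨾ k ≈ ι₁ ⨾ h' → ι₂ ⨾ k ≈ ι₂ ⨾ h' → k ≈ [ ι₁ ⨾ h' , ι₂ ⨾ h' ]
        unique = proj₂ (proj₂ (proj₂ (⊕.copair (ι₁ ⨾ h') (ι₂ ⨾ h'))))

      ⟨⟩-resp : {f f' : Hom C A} {g g' : Hom C B} → f ≈ f' → g ≈ g' → ⟨ f , g ⟩ ≈ ⟨ f' , g' ⟩
      ⟨⟩-resp f≈f' g≈g' =
        π-ext (Equiv.trans project₁ (Equiv.trans f≈f' (Equiv.sym project₁)))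
              (Equiv.trans project₂ (Equiv.trans g≈g' (Equiv.sym project₂)))

      []-resp : {f f' : Hom A C} {g g' : Hom B C} → f ≈ f' → g ≈ g' → [ f , g ] ≈ [ f' , g' ]
      []-resp f≈f' g≈g' =
        ι-ext (Equiv.trans inject₁ (Equiv.trans f≈f' (Equiv.sym inject₁)))
              (Equiv.trans inject₂ (Equiv.trans g≈g' (Equiv.sym inject₂)))

      ⨾-⟨⟩ : {h : Hom D C} {f : Hom C A} {g : Hom C B} → h ⨾ ⟨ f , g ⟩ ≈ ⟨ h ⨾ f , h ⨾ g ⟩
      ⨾-⟨⟩ = π-ext (Equiv.trans assoc (Equiv.trans (refl⟩⨾⟨ project₁) (Equiv.sym project₁)))
                   (Equiv.trans assoc (Equiv.trans (refl⟩⨾⟨ project₂) (Equiv.sym project₂)))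

      []-⨾ : {f : Hom A C} {g : Hom B C} {h : Hom C D} → [ f , g ] ⨾ h ≈ [ f ⨾ h , g ⨾ h ]
      []-⨾ = ι-ext (Equiv.trans sym-assoc (Equiv.trans (inject₁ ⟩⨾⟨refl) (Equiv.sym inject₁)))
                   (Equiv.trans sym-assoc (Equiv.trans (inject₂ ⟩⨾⟨refl) (Equiv.sym inject₂)))

      ⟨id,zero⟩≈ι₁ : ⟨ id , zero ⟩ ≈ ι₁ {A} {B}
      ⟨id,zero⟩≈ι₁ = π-ext (Equiv.trans project₁ (Equiv.sym ⊕.ι₁π₁))
                           (Equiv.trans project₂ (Equiv.sym ⊕.ι₁π₂))

      ⟨zero,id⟩≈ι₂ : ⟨ zero , id ⟩ ≈ ι₂ {A} {B}
      ⟨zero,id⟩≈ι₂ = π-ext (Equiv.trans project₁ (Equiv.sym ⊕.ι₂π₁))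
                           (Equiv.trans project₂ (Equiv.sym ⊕.ι₂π₂))

      ⟨f,zero⟩≈f⨾ι₁ : {f : Hom C A} → ⟨ f , zero {C} {B} ⟩ ≈ f ⨾ ι₁
      ⟨f,zero⟩≈f⨾ι₁ {f = f} = begin
        ⟨ f , zero ⟩            ≈⟨ ⟨⟩-resp idʳ zeroʳ ⟨
        ⟨ f ⨾ id , f ⨾ zero ⟩  ≈⟨ ⨾-⟨⟩ ⟨
        f ⨾ ⟨ id , zero ⟩      ≈⟨ refl⟩⨾⟨ ⟨id,zero⟩≈ι₁ ⟩
        f ⨾ ι₁                  ∎

      ⟨zero,f⟩≈f⨾ι₂ : {f : Hom C B} → ⟨ zero {C} {A} , f ⟩ ≈ f ⨾ ι₂
      ⟨zero,f⟩≈f⨾ι₂ {f = f} = begin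
        ⟨ zero , f ⟩            ≈⟨ ⟨⟩-resp zeroʳ idʳ ⟨
        ⟨ f ⨾ zero , f ⨾ id ⟩  ≈⟨ ⨾-⟨⟩ ⟨
        f ⨾ ⟨ zero , id ⟩      ≈⟨ refl⟩⨾⟨ ⟨zero,id⟩≈ι₂ ⟩
        f ⨾ ι₂                  ∎

      ι₁-⊕₁ : {h : Hom A B} {k : Hom C D} → ι₁ ⨾ (h ⊕₁ k) ≈ h ⨾ ι₁
      ι₁-⊕₁ {h = h} {k} = Equiv.trans ⨾-⟨⟩ (Equiv.trans (⟨⟩-resp ι₁π₁h ι₁π₂k) ⟨f,zero⟩≈f⨾ι₁)
        where
        ι₁π₁h : ι₁ ⨾ π₁ ⨾ h ≈ h
        ι₁π₁h = Equiv.trans sym-assoc (Equiv.trans (⊕.ι₁π₁ ⟩⨾⟨refl) idˡ)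
        ι₁π₂k : ι₁ ⨾ π₂ ⨾ k ≈ zero
        ι₁π₂k = Equiv.trans sym-assoc (Equiv.trans (⊕.ι₁π₂ ⟩⨾⟨refl) zeroˡ)

      ι₂-⊕₁ : {h : Hom A B} {k : Hom C D} → ι₂ ⨾ (h ⊕₁ k) ≈ k ⨾ ι₂
      ι₂-⊕₁ {h = h} {k} = Equiv.trans ⨾-⟨⟩ (Equiv.trans (⟨⟩-resp ι₂π₁h ι₂π₂k) ⟨zero,f⟩≈f⨾ι₂)
        where
        ι₂π₁h : ι₂ ⨾ π₁ ⨾ h ≈ zero
        ι₂π₁h = Equiv.trans sym-assoc (Equiv.trans (⊕.ι₂π₁ ⟩⨾⟨refl) zeroˡ)
        ι₂π₂k : ι₂ ⨾ π₂ ⨾ k ≈ k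
        ι₂π₂k = Equiv.trans sym-assoc (Equiv.trans (⊕.ι₂π₂ ⟩⨾⟨refl) idˡ)

      ⟨⟩-⊕₁ : {f : Hom E A} {g : Hom E C} {h : Hom A B} {k : Hom C D} →
              ⟨ f , g ⟩ ⨾ (h ⊕₁ k) ≈ ⟨ f ⨾ h , g ⨾ k ⟩
      ⟨⟩-⊕₁ = Equiv.trans ⨾-⟨⟩ (⟨⟩-resp (Equiv.trans sym-assoc (project₁ ⟩⨾⟨refl))
                                         (Equiv.trans sym-assoc (project₂ ⟩⨾⟨refl)))

      ⊕₁-resp : {h h' : Hom A B} {k k' : Hom C D} → h ≈ h' → k ≈ k' → h ⊕₁ k ≈ h' ⊕₁ k'
      ⊕₁-resp h≈h' k≈k' = ⟨⟩-resp (refl⟩⨾⟨ h≈h') (refl⟩⨾⟨ k≈k')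

      ⊕₁-⨾ : {a : Hom A B} {b : Hom C D} {c : Hom B E} {d : Hom D F} →
             (a ⊕₁ b) ⨾ (c ⊕₁ d) ≈ (a ⨾ c) ⊕₁ (b ⨾ d)
      ⊕₁-⨾ = Equiv.trans ⟨⟩-⊕₁ (⟨⟩-resp assoc assoc)

      ⊕₁-zero : {h : Hom A B} → h ⊕₁ zero {C} {D} ≈ π₁ ⨾ h ⨾ ι₁
      ⊕₁-zero {h = h} = π-ext (Equiv.trans project₁ (Equiv.sym π₁hι₁π₁))
                               (Equiv.trans project₂ (Equiv.trans zeroʳ (Equiv.sym π₁hι₁π₂)))
        where
        π₁hι₁π₁ : (π₁ ⨾ h ⨾ ι₁) ⨾ π₁ ≈ π₁ ⨾ h
        π₁hι₁π₁ = Equiv.trans assoc (refl⟩⨾⟨ Equiv.trans assoc (Equiv.trans (refl⟩⨾⟨ ⊕.ι₁π₁) idʳ))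
        π₁hι₁π₂ : (π₁ ⨾ h ⨾ ι₁) ⨾ π₂ ≈ zero
        π₁hι₁π₂ = Equiv.trans assoc
                    (Equiv.trans (refl⟩⨾⟨ Equiv.trans assoc (Equiv.trans (refl⟩⨾⟨ ⊕.ι₁π₂) zeroʳ)) zeroʳ)

      ι₁-⨾-† : {h : Hom C (A ⊕ B)} → ι₁ ⨾ h † ≈ (h ⨾ π₁) †
      ι₁-⨾-† = Equiv.trans (Equiv.sym ⊕.π₁† ⟩⨾⟨refl) (Equiv.sym †-comp)

      ι₂-⨾-† : {h : Hom C (A ⊕ B)} → ι₂ ⨾ h † ≈ (h ⨾ π₂) †
      ι₂-⨾-† = Equiv.trans (Equiv.sym ⊕.π₂† ⟩⨾⟨refl) (Equiv.sym †-comp)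

      ⟨⟩-† : {f : Hom C A} {g : Hom C B} → ⟨ f , g ⟩ † ≈ [ f † , g † ]
      ⟨⟩-† = ι-ext (Equiv.trans ι₁-⨾-† (Equiv.trans (†-resp project₁) (Equiv.sym inject₁)))
                   (Equiv.trans ι₂-⨾-† (Equiv.trans (†-resp project₂) (Equiv.sym inject₂)))

      ⊕₁-† : {h : Hom A B} {k : Hom C D} → (h ⊕₁ k) † ≈ h † ⊕₁ k †
      ⊕₁-† {h = h} {k} = ι-ext
        (begin
          ι₁ ⨾ (h ⊕₁ k) †      ≈⟨ ι₁-⨾-† ⟩
          ((h ⊕₁ k) ⨾ π₁) †    ≈⟨ †-resp project₁ ⟩
          (π₁ ⨾ h) †           ≈⟨ †-comp ⟩
          h † ⨾ π₁ †           ≈⟨ refl⟩⨾⟨ ⊕.π₁† ⟩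
          h † ⨾ ι₁             ≈⟨ ι₁-⊕₁ ⟨
          ι₁ ⨾ (h † ⊕₁ k †)    ∎)
        (begin
          ι₂ ⨾ (h ⊕₁ k) †      ≈⟨ ι₂-⨾-† ⟩
          ((h ⊕₁ k) ⨾ π₂) †    ≈⟨ †-resp project₂ ⟩
          (π₂ ⨾ k) †           ≈⟨ †-comp ⟩
          k † ⨾ π₂ †           ≈⟨ refl⟩⨾⟨ ⊕.π₂† ⟩
          k † ⨾ ι₂             ≈⟨ ι₂-⊕₁ ⟨
          ι₂ ⨾ (h † ⊕₁ k †)    ∎)

      ⊕₁-isMoorePenroseInverse : {f : Hom A B} {g : Hom B A} {f' : Hom C D} {g' : Hom D C} →
        IsMoorePenroseInverse 𝕏 f g → IsMoorePenroseInverse 𝕏 f' g' →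
        IsMoorePenroseInverse 𝕏 (f ⊕₁ f') (g ⊕₁ g')
      ⊕₁-isMoorePenroseInverse (fgf , gfg , fg† , gf†) (fgf' , gfg' , fg†' , gf†') =
        Equiv.trans (refl⟩⨾⟨ ⊕₁-⨾) (Equiv.trans ⊕₁-⨾ (⊕₁-resp fgf fgf')) ,
        Equiv.trans (refl⟩⨾⟨ ⊕₁-⨾) (Equiv.trans ⊕₁-⨾ (⊕₁-resp gfg gfg')) ,
        ⊕₁-self-adjoint fg† fg†' ,
        ⊕₁-self-adjoint gf† gf†'
        where
        ⊕₁-self-adjoint : {a : Hom E F} {b : Hom F E} {a' : Hom A B} {b' : Hom B A} →
                          (a ⨾ b) † ≈ a ⨾ b → (a' ⨾ b') † ≈ a' ⨾ b' →
                          ((a ⊕₁ a') ⨾ (b ⊕₁ b')) † ≈ (a ⊕₁ a') ⨾ (b ⊕₁ b')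
        ⊕₁-self-adjoint ab† ab†' =
          Equiv.trans (†-resp ⊕₁-⨾) (Equiv.trans ⊕₁-† (Equiv.trans (⊕₁-resp ab† ab†') (Equiv.sym ⊕₁-⨾)))

      +-resp : {f f' g g' : Hom A B} → f ≈ f' → g ≈ g' → f + g ≈ f' + g'
      +-resp f≈f' g≈g' = ⟨⟩-resp f≈f' g≈g' ⟩⨾⟨refl

      []≈⊕₁⨾∇ : {h : Hom A C} {k : Hom B C} → [ h , k ] ≈ (h ⊕₁ k) ⨾ ∇
      []≈⊕₁⨾∇ {h = h} {k} = ι-ext
        (begin
          ι₁ ⨾ [ h , k ]         ≈⟨ inject₁ ⟩
          h                      ≈⟨ idʳ ⟨
          h ⨾ id                 ≈⟨ refl⟩⨾⟨ inject₁ ⟨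
          h ⨾ ι₁ ⨾ ∇             ≈⟨ sym-assoc ⟩
          (h ⨾ ι₁) ⨾ ∇           ≈⟨ ι₁-⊕₁ ⟩⨾⟨refl ⟨
          (ι₁ ⨾ (h ⊕₁ k)) ⨾ ∇    ≈⟨ assoc ⟩
          ι₁ ⨾ (h ⊕₁ k) ⨾ ∇      ∎)
        (begin
          ι₂ ⨾ [ h , k ]         ≈⟨ inject₂ ⟩
          k                      ≈⟨ idʳ ⟨
          k ⨾ id                 ≈⟨ refl⟩⨾⟨ inject₂ ⟨
          k ⨾ ι₂ ⨾ ∇             ≈⟨ sym-assoc ⟩
          (k ⨾ ι₂) ⨾ ∇           ≈⟨ ι₂-⊕₁ ⟩⨾⟨refl ⟨
          (ι₂ ⨾ (h ⊕₁ k)) ⨾ ∇    ≈⟨ assoc ⟩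
          ι₂ ⨾ (h ⊕₁ k) ⨾ ∇      ∎)

      ⟨⟩-[] : {f : Hom C A} {g : Hom C B} {h : Hom A D} {k : Hom B D} →
              ⟨ f , g ⟩ ⨾ [ h , k ] ≈ f ⨾ h + g ⨾ k
      ⟨⟩-[] = Equiv.trans (refl⟩⨾⟨ []≈⊕₁⨾∇) (Equiv.trans sym-assoc (⟨⟩-⊕₁ ⟩⨾⟨refl))

      ⨾-distribˡ-+ : {h : Hom C A} {f g : Hom A B} → h ⨾ (f + g) ≈ h ⨾ f + h ⨾ g
      ⨾-distribˡ-+ = Equiv.trans sym-assoc (⨾-⟨⟩ ⟩⨾⟨refl)

      ⨾-distribʳ-+ : {f g : Hom A B} {h : Hom B C} → (f + g) ⨾ h ≈ f ⨾ h + g ⨾ h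
      ⨾-distribʳ-+ {h = h} = Equiv.trans assoc (Equiv.trans (refl⟩⨾⟨ ∇⨾h) ⟨⟩-[])
        where
        ∇⨾h : ∇ ⨾ h ≈ [ h , h ]
        ∇⨾h = Equiv.trans []-⨾ ([]-resp idˡ idˡ)

      +-identityʳ : {f : Hom A B} → f + zero ≈ f
      +-identityʳ = Equiv.trans (⟨f,zero⟩≈f⨾ι₁ ⟩⨾⟨refl)
                      (Equiv.trans assoc (Equiv.trans (refl⟩⨾⟨ inject₁) idʳ))

      +-identityˡ : {f : Hom A B} → zero + f ≈ f
      +-identityˡ = Equiv.trans (⟨zero,f⟩≈f⨾ι₂ ⟩⨾⟨refl)
                      (Equiv.trans assoc (Equiv.trans (refl⟩⨾⟨ inject₂) idʳ))

      ⟨⟩-+ : {a b : Hom C A} {c d : Hom C B} → ⟨ a , c ⟩ + ⟨ b , d ⟩ ≈ ⟨ a + b , c + d ⟩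
      ⟨⟩-+ = π-ext (Equiv.trans ⨾-distribʳ-+ (Equiv.trans (+-resp project₁ project₁) (Equiv.sym project₁)))
                   (Equiv.trans ⨾-distribʳ-+ (Equiv.trans (+-resp project₂ project₂) (Equiv.sym project₂)))

      -- Eckmann-Hilton: interchange with the units makes + commutative and associative.
      +-interchange : {a b c d : Hom A B} → (a + b) + (c + d) ≈ (a + c) + (b + d)
      +-interchange = Equiv.trans (Equiv.sym ⟨⟩-+ ⟩⨾⟨refl) ⨾-distribʳ-+

      +-comm : {a b : Hom A B} → a + b ≈ b + a
      +-comm {a = a} {b} = begin
        a + b                    ≈⟨ +-resp +-identityˡ +-identityʳ ⟨
        (zero + a) + (b + zero)  ≈⟨ +-interchange ⟩
        (zero + b) + (a + zero)  ≈⟨ +-resp +-identityˡ +-identityʳ ⟩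
        b + a                    ∎

      +-assoc : {a b c : Hom A B} → (a + b) + c ≈ a + (b + c)
      +-assoc {a = a} {b} {c} = begin
        (a + b) + c              ≈⟨ +-resp Equiv.refl +-identityˡ ⟨
        (a + b) + (zero + c)     ≈⟨ +-interchange ⟩
        (a + zero) + (b + c)     ≈⟨ +-resp +-identityʳ Equiv.refl ⟩
        a + (b + c)              ∎

      +-† : {f g : Hom A B} → (f + g) † ≈ f † + g †
      +-† {f = f} {g} = begin
        (⟨ f , g ⟩ ⨾ ∇) †             ≈⟨ †-comp ⟩
        ∇ † ⨾ ⟨ f , g ⟩ †             ≈⟨ ∇-† ⟩⨾⟨ ⟨⟩-† ⟩
        ⟨ id , id ⟩ ⨾ [ f † , g † ]   ≈⟨ ⟨⟩-[] ⟩
        id ⨾ f † + id ⨾ g †           ≈⟨ +-resp idˡ idˡ ⟩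
        f † + g †                     ∎
        where
        ∇-† : ∇ {B} † ≈ ⟨ id , id ⟩
        ∇-† = Equiv.trans (†-resp (Equiv.sym (Equiv.trans ⟨⟩-† ([]-resp †-id †-id)))) †-invol

      +-inverseʳ-unique : {f m m' : Hom A B} → f + m ≈ zero → f + m' ≈ zero → m ≈ m'
      +-inverseʳ-unique {f = f} {m} {m'} f+m f+m' = begin
        m               ≈⟨ +-identityʳ ⟨
        m + zero        ≈⟨ +-resp Equiv.refl f+m' ⟨
        m + (f + m')    ≈⟨ +-assoc ⟨
        (m + f) + m'    ≈⟨ +-resp +-comm Equiv.refl ⟩
        (f + m) + m'    ≈⟨ +-resp f+m Equiv.refl ⟩
        zero + m'       ≈⟨ +-identityˡ ⟩
        m'              ∎

      complement-sum : {ε m : Hom A A} → ε + m ≈ zero → ε + (id + m) ≈ id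
      complement-sum {ε = ε} {m} ε+m = begin
        ε + (id + m)   ≈⟨ +-assoc ⟨
        (ε + id) + m   ≈⟨ +-resp +-comm Equiv.refl ⟩
        (id + ε) + m   ≈⟨ +-assoc ⟩
        id + (ε + m)   ≈⟨ +-resp Equiv.refl ε+m ⟩
        id + zero      ≈⟨ +-identityʳ ⟩
        id             ∎

      complement-annihilates : {ε m : Hom A A} → ε ⨾ ε ≈ ε → ε + m ≈ zero → (id + m) ⨾ ε ≈ zero
      complement-annihilates {ε = ε} {m} εε ε+m = begin
        (id + m) ⨾ ε       ≈⟨ ⨾-distribʳ-+ ⟩
        id ⨾ ε + m ⨾ ε     ≈⟨ +-resp (Equiv.trans idˡ (Equiv.sym εε)) Equiv.refl ⟩
        ε ⨾ ε + m ⨾ ε      ≈⟨ ⨾-distribʳ-+ ⟨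
        (ε + m) ⨾ ε        ≈⟨ ε+m ⟩⨾⟨refl ⟩
        zero ⨾ ε           ≈⟨ zeroˡ ⟩
        zero               ∎

      complement-self-adjoint : {ε m : Hom A A} → ε † ≈ ε → ε + m ≈ zero → (id + m) † ≈ id + m
      complement-self-adjoint {ε = ε} {m} ε† ε+m =
        Equiv.trans +-† (+-resp †-id (+-inverseʳ-unique ε+m† ε+m))
        where
        ε+m† : ε + m † ≈ zero
        ε+m† = begin
          ε + m †      ≈⟨ +-resp ε† Equiv.refl ⟨
          ε † + m †    ≈⟨ +-† ⟨
          (ε + m) †    ≈⟨ †-resp ε+m ⟩
          zero †       ≈⟨ zero-† ⟩
          zero         ∎

      complement-idempotent : {ε c : Hom A A} → c ⨾ ε ≈ zero → ε + c ≈ id → c ⨾ c ≈ c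
      complement-idempotent {ε = ε} {c} cε ε+c = begin
        c ⨾ c              ≈⟨ +-identityˡ ⟨
        zero + c ⨾ c       ≈⟨ +-resp cε Equiv.refl ⟨
        c ⨾ ε + c ⨾ c      ≈⟨ ⨾-distribˡ-+ ⟨
        c ⨾ (ε + c)        ≈⟨ refl⟩⨾⟨ ε+c ⟩
        c ⨾ id             ≈⟨ idʳ ⟩
        c                  ∎

      ⟨⟩-unitary : {r : Hom A B} {s : Hom A C} →
                   r † ⨾ r ≈ id → s † ⨾ s ≈ id → s † ⨾ r ≈ zero → r ⨾ r † + s ⨾ s † ≈ id →
                   IsUnitary 𝕏 ⟨ r , s ⟩
      ⟨⟩-unitary {r = r} {s} r†r s†s s†r rr†+ss† =
        Equiv.trans (refl⟩⨾⟨ ⟨⟩-†) (Equiv.trans ⟨⟩-[] rr†+ss†) ,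
        ι-ext
          (begin
            ι₁ ⨾ ⟨ r , s ⟩ † ⨾ ⟨ r , s ⟩       ≈⟨ sym-assoc ⟩
            (ι₁ ⨾ ⟨ r , s ⟩ †) ⨾ ⟨ r , s ⟩     ≈⟨ Equiv.trans ι₁-⨾-† (†-resp project₁) ⟩⨾⟨refl ⟩
            r † ⨾ ⟨ r , s ⟩                     ≈⟨ ⨾-⟨⟩ ⟩
            ⟨ r † ⨾ r , r † ⨾ s ⟩               ≈⟨ ⟨⟩-resp r†r r†s ⟩
            ⟨ id , zero ⟩                       ≈⟨ ⟨id,zero⟩≈ι₁ ⟩
            ι₁                                  ≈⟨ idʳ ⟨
            ι₁ ⨾ id                             ∎)
          (begin
            ι₂ ⨾ ⟨ r , s ⟩ † ⨾ ⟨ r , s ⟩       ≈⟨ sym-assoc ⟩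
            (ι₂ ⨾ ⟨ r , s ⟩ †) ⨾ ⟨ r , s ⟩     ≈⟨ Equiv.trans ι₂-⨾-† (†-resp project₂) ⟩⨾⟨refl ⟩
            s † ⨾ ⟨ r , s ⟩                     ≈⟨ ⨾-⟨⟩ ⟩
            ⟨ s † ⨾ r , s † ⨾ s ⟩               ≈⟨ ⟨⟩-resp s†r s†s ⟩
            ⟨ zero , id ⟩                       ≈⟨ ⟨zero,id⟩≈ι₂ ⟩
            ι₂                                  ≈⟨ idʳ ⟨
            ι₂ ⨾ id                             ∎)
        where
        r†s : r † ⨾ s ≈ zero
        r†s = begin
          r † ⨾ s        ≈⟨ refl⟩⨾⟨ †-invol ⟨
          r † ⨾ s † †    ≈⟨ †-comp ⟨
          (s † ⨾ r) †    ≈⟨ †-resp s†r ⟩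
          zero †         ≈⟨ zero-† ⟩
          zero           ∎

      DaggerSplitting : Hom A A → Set (o ⊔ ℓ ⊔ e)
      DaggerSplitting {A} ε = Σ Obj λ X → Σ (Hom A X) λ r → (r ⨾ r † ≈ ε) × (r † ⨾ r ≈ id)

      record UnitarySplitting {A : Obj} (ε : Hom A A) : Set (o ⊔ ℓ ⊔ e) where
        field
          Im Im⊥ : Obj
          r : Hom A Im
          u : Hom A (Im ⊕ Im⊥)
          r⨾r† : r ⨾ r † ≈ ε
          r†⨾r : r † ⨾ r ≈ id
          u-unitary : IsUnitary 𝕏 u
          u⨾π₁ : u ⨾ π₁ ≈ r

      complementary-splittings⇒unitarySplitting : {ε c : Hom A A} →
        DaggerSplitting ε → DaggerSplitting c → c ⨾ ε ≈ zero → ε + c ≈ id → UnitarySplitting ε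
      complementary-splittings⇒unitarySplitting (X , r , rr† , r†r) (W , s , ss† , s†s) cε ε+c = record
        { Im = X ; Im⊥ = W ; r = r ; u = ⟨ r , s ⟩ ; r⨾r† = rr† ; r†⨾r = r†r
        ; u-unitary = ⟨⟩-unitary r†r s†s (splittings-orthogonal rr† r†r ss† s†s cε)
                                 (Equiv.trans (+-resp rr† ss†) ε+c)
        ; u⨾π₁ = project₁
        }

      unitarySplitting : DaggerIdempotentComplete 𝕏 → HasNegatives 𝕏 Z BP →
                         {ε : Hom A A} → ε ⨾ ε ≈ ε → ε † ≈ ε → UnitarySplitting ε
      unitarySplitting {A = A} dic neg {ε} εε ε† =
        complementary-splittings⇒unitarySplitting
          (dic ε εε ε†) (dic c (complement-idempotent cε ε+c) (complement-self-adjoint ε† ε+m)) cε ε+c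
        where
        m : Hom A A
        m = proj₁ (neg ε)
        ε+m : ε + m ≈ zero
        ε+m = proj₂ (neg ε)
        c : Hom A A
        c = id + m
        cε : c ⨾ ε ≈ zero
        cε = complement-annihilates εε ε+m
        ε+c : ε + c ≈ id
        ε+c = complement-sum ε+m

      ⨾-⊕₁zero-⨾† : {u : Hom A (C ⊕ E)} {h : Hom C D} {w : Hom B (D ⊕ F)} →
                    u ⨾ (h ⊕₁ zero) ⨾ w † ≈ (u ⨾ π₁) ⨾ h ⨾ (w ⨾ π₁) †
      ⨾-⊕₁zero-⨾† {u = u} {h} {w} = begin
        u ⨾ (h ⊕₁ zero) ⨾ w †        ≈⟨ refl⟩⨾⟨ ⊕₁-zero ⟩⨾⟨refl ⟩
        u ⨾ (π₁ ⨾ h ⨾ ι₁) ⨾ w †      ≈⟨ sym-assoc ⟩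
        (u ⨾ π₁ ⨾ h ⨾ ι₁) ⨾ w †      ≈⟨ sym-assoc ⟩⨾⟨refl ⟩
        ((u ⨾ π₁) ⨾ h ⨾ ι₁) ⨾ w †    ≈⟨ assoc ⟩
        (u ⨾ π₁) ⨾ (h ⨾ ι₁) ⨾ w †    ≈⟨ refl⟩⨾⟨ assoc ⟩
        (u ⨾ π₁) ⨾ h ⨾ ι₁ ⨾ w †      ≈⟨ refl⟩⨾⟨ refl⟩⨾⟨ ι₁-⨾-† ⟩
        (u ⨾ π₁) ⨾ h ⨾ (w ⨾ π₁) †    ∎

      gsvd⇒mp : {f : Hom A B} → HasGSVD 𝕏 Z BP f → MoorePenroseInvertible 𝕏 f
      gsvd⇒mp (_ , _ , _ , _ , u , d , v , u-unitary , (d⁻¹ , dd⁻¹ , d⁻¹d) , v-unitary , f≈udv) =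
        v † ⨾ (d⁻¹ ⊕₁ zero) ⨾ u † ,
        isMoorePenroseInverse-resp f≈udv
          (isMoorePenroseInverse-unitary-conj u-unitary v-unitary
            (⊕₁-isMoorePenroseInverse (inverse⇒isMoorePenroseInverse dd⁻¹ d⁻¹d) zero-isMoorePenroseInverse))

      mp⇒gsvd : DaggerIdempotentComplete 𝕏 → HasNegatives 𝕏 Z BP →
                {f : Hom A B} → MoorePenroseInvertible 𝕏 f → HasGSVD 𝕏 Z BP f
      mp⇒gsvd dic neg {f} (g , mp@(fgf , gfg , fg† , gf†)) =
        Im S , Im T , Im⊥ S , Im⊥ T , u S , d , u T † ,
        u-unitary S , (d⁻¹ , d⨾d⁻¹ , d⁻¹⨾d) , unitary-† (u-unitary T) , f≈udv
        where
        open UnitarySplitting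
        S : UnitarySplitting (f ⨾ g)
        S = unitarySplitting dic neg (isMoorePenroseInverse⇒idempotent mp) fg†
        T : UnitarySplitting (g ⨾ f)
        T = unitarySplitting dic neg (isMoorePenroseInverse⇒idempotent (isMoorePenroseInverse-sym mp)) gf†
        d : Hom (Im S) (Im T)
        d = r S † ⨾ f ⨾ r T
        d⁻¹ : Hom (Im T) (Im S)
        d⁻¹ = r T † ⨾ g ⨾ r S
        d⨾d⁻¹ : d ⨾ d⁻¹ ≈ id
        d⨾d⁻¹ = compression-inverse gfg (r⨾r† S) (r†⨾r S) (r⨾r† T)
        d⁻¹⨾d : d⁻¹ ⨾ d ≈ id
        d⁻¹⨾d = compression-inverse fgf (r⨾r† T) (r†⨾r T) (r⨾r† S)
        f≈udv : f ≈ u S ⨾ (d ⊕₁ zero) ⨾ u T †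
        f≈udv = begin
          f                               ≈⟨ compression-reconstructs fgf (r⨾r† S) (r⨾r† T) ⟨
          r S ⨾ d ⨾ r T †                 ≈⟨ u⨾π₁ S ⟩⨾⟨ refl⟩⨾⟨ †-resp (u⨾π₁ T) ⟨
          (u S ⨾ π₁) ⨾ d ⨾ (u T ⨾ π₁) †   ≈⟨ ⨾-⊕₁zero-⨾† ⟨
          u S ⨾ (d ⊕₁ zero) ⨾ u T †       ∎

mainTheorem2 : ∀ {o ℓ e : Level} (𝕏 : DaggerCategory o ℓ e) (Z : ZeroObject 𝕏) →
                 HasDaggerKernels 𝕏 Z → DaggerIdempotentComplete 𝕏 →
                 (BP : FiniteDaggerBiproducts 𝕏 Z) → HasNegatives 𝕏 Z BP →
                 ∀ {A B : DaggerCategory.Obj 𝕏} (f : DaggerCategory.Hom 𝕏 A B) →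
                 MoorePenroseInvertible 𝕏 f ⇔ HasGSVD 𝕏 Z BP f
mainTheorem2 𝕏 Z _ dic BP neg f = mk⇔ (mp⇒gsvd 𝕏 Z BP dic neg) (gsvd⇒mp 𝕏 Z BP)
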